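{- For every integer $n>8$, the circulant graph $\Gamma(n,\pm\{1,2,3,4\})$ is Fibonacci cordial.
   Context: The Fibonacci numbers are defined by $F_0=0$, $F_1=F_2=1$, $F_n=F_{n-1}+F_{n-2}$. For a graph $G$ with $N$ vertices, a Fibonacci cordial labeling is an injective function $f:V(G)\to\{F_0,F_1,\dots,F_N\}$ (labels $F_i$ with distinct indices are regarded as distinct labels) such that the induced edge labeling $f^*(uv)=(f(u)+f(v)) \bmod 2$ satisfies $|\varepsilon_0-\varepsilon_1|\le 1$, where $\varepsilon_i$ is the number of edges labeled $i$. A graph admitting such a labeling is called Fibonacci cordial. For $S\subset\mathbb{Z}_n$ with $0\notin S$ and $S=-S$, the circulant graph $\Gamma(n,S)$ has vertex set $\mathbb{Z}_n$ and edges $\{u,v\}$ with $v-u\in S$; $\pm\{1,2,3,4\}=\{\pm1,\pm2,\pm3,\pm4\}\subset\mathbb{Z}_n$. -}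

module Defs where

open import Data.Nat using (ℕ; zero; suc; _+_; _∸_; _<_; _≤_; _<ᵇ_; _≡ᵇ_; NonZero)
open import Data.Nat.DivMod using (_%_)
open import Data.Bool using (Bool; true; false; _∧_; if_then_else_)
open import Data.Fin using (Fin; toℕ)
open import Data.List using (List; []; _∷_; _++_; map; concatMap; filter; length; allFin)
open import Data.Bool.ListAction using (any)
open import Data.Product using (_×_; _,_; proj₁; proj₂)
open import Function.Definitions using (Injective)
open import Relation.Binary.PropositionalEquality using (_≡_)
open import Relation.Nullary.Decidable using (yes; no)

fib : ℕ → ℕ
fib zero = 0
fib (suc zero) = 1
fib (suc (suc n)) = fib (suc n) + fib n

record Graph (n : ℕ) : Set where
  field
    adj : Fin n → Fin n → Bool

open Graph public

edges : ∀ {n} → Graph n → List (Fin n × Fin n)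
edges {n} G =
  concatMap (λ u → concatMap (λ v →
     if (toℕ u <ᵇ toℕ v) ∧ adj G u v then (u , v) ∷ [] else []) (allFin n)) (allFin n)

-- Circulant graph Γ(n, S) with S ⊆ ℤ_n given by a list of representatives
-- in {0,…,n-1}; u ~ v iff (v - u) mod n ∈ S.
circulant : (n : ℕ) → .{{NonZero n}} → List ℕ → Graph n
circulant n S = record
  { adj = λ u v → any (λ s → ((toℕ v + n ∸ toℕ u) % n) ≡ᵇ s) S }

pm1234 : ℕ → List ℕ
pm1234 n = 1 ∷ 2 ∷ 3 ∷ 4 ∷ (n ∸ 1) ∷ (n ∸ 2) ∷ (n ∸ 3) ∷ (n ∸ 4) ∷ []

-- Induced edge label of the labeling f (f u = index i of the label F_i)
edgeLabel : ∀ {n} → (Fin n → Fin (suc n)) → Fin n × Fin n → ℕ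
edgeLabel f (u , v) = (fib (toℕ (f u)) + fib (toℕ (f v))) % 2

countLabel : ∀ {n} → Graph n → (Fin n → Fin (suc n)) → ℕ → ℕ
countLabel G f b = length (filter (λ e → edgeLabel f e Data.Nat.≟ b) (edges G))

-- Fibonacci cordial labeling: injective f : V → {F₀,…,F_N} (by index)
-- with |ε₀ - ε₁| ≤ 1.
IsFibonacciCordialLabeling : ∀ {n} → Graph n → (Fin n → Fin (suc n)) → Set
IsFibonacciCordialLabeling G f =
  Injective _≡_ _≡_ f
  × countLabel G f 0 ≤ suc (countLabel G f 1)
  × countLabel G f 1 ≤ suc (countLabel G f 0)

record FibonacciCordial {n : ℕ} (G : Graph n) : Set where
  field
    labeling : Fin n → Fin (suc n)
    isFC     : IsFibonacciCordialLabeling G labeling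

-- Vertex i is labelled F_σ(i), where σ = labelIndex cycles 0 ↦ 1 ↦ 2 ↦ 0 and fixes every
-- i ≥ 3. Since F_i is even exactly when 3 ∣ i, the label parities are 1, 1, 0 followed by
-- the 3-periodic pattern 0, 1, 1, … . Grouping the edges of Γ(n, ±{1,2,3,4}) by their
-- difference turns ε₀ and ε₁ into sums of eventually 3-periodic sequences over ranges that
-- all lengthen by 3 when n does, so passing from n to n + 3 adds a fixed window sum to
-- each, and both window sums equal 6. Hence ε₀ = ε₁ follows from the cases n = 9, 10, 11,
-- which are checked by evaluation; n > 8 also makes the eight representatives of
-- ±{1,2,3,4} distinct, so that each edge is counted once.
{-# OPTIONS --safe #-}
module Submission where

open import Defs
open import Data.Nat using (ℕ; _<_; NonZero)
open import Data.Nat using (zero; suc; _+_; _*_; _∸_; _≤_; _<ᵇ_; _≡ᵇ_; z≤n; s≤s; z<s)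
open import Data.Nat.Properties
open import Data.Nat.DivMod using (_%_; %-distribˡ-+; [m+kn]%n≡m%n; [m+n]%n≡m%n; m<n⇒m%n≡m)
open import Data.Nat.Solver using (module +-*-Solver)
import Data.Nat.ListAction as List
open import Data.Nat.ListAction.Properties using (sum-++)
open import Algebra.Properties.CommutativeMonoid.Sum +-0-commutativeMonoid
  using (sum-syntax; sum-cong-≗; ∑-distrib-+; sum-replicate-zero)
open import Algebra.Properties.CommutativeSemigroup +-commutativeSemigroup
  using (interchange; xy∙z≈xz∙y; x∙yz≈y∙xz)
open import Data.Bool using (Bool; true; false; _∧_; _∨_; if_then_else_)
open import Data.Bool.ListAction using (any)
open import Data.Fin as Fin using (Fin; toℕ; fromℕ<)
open import Data.Fin.Properties using (toℕ-fromℕ<; toℕ-injective; toℕ<n)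
open import Data.List using (List; []; _∷_; _++_; map; concatMap; filter; length; tabulate; allFin)
open import Data.List.Properties using (map-++; map-cong; filter-++; length-++)
open import Data.List.Relation.Unary.All as All using (All; []; _∷_)
open import Data.List.Relation.Unary.AllPairs using (AllPairs; []; _∷_)
open import Data.Product using (_×_; _,_)
open import Data.Sum using (inj₁; inj₂)
open import Function using (_∘_; id; mk⇔)
open import Function.Definitions using (Injective)
open import Relation.Binary.PropositionalEquality
open import Relation.Nullary using (Dec; does; yes; no)
open import Relation.Nullary.Decidable using (dec-false; does-⇔)
open import Relation.Nullary.Reflects using (ofʸ; ofⁿ)
open import Relation.Unary using (Pred; Decidable)
open import Level using (0ℓ)

open ≡-Reasoning

∑-sum-comm : ∀ {A : Set} n (xs : List A) (f : Fin n → A → ℕ) →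
             ∑[ i < n ] List.sum (map (f i) xs) ≡ List.sum (map (λ x → ∑[ i < n ] f i x) xs)
∑-sum-comm n []       f = sum-replicate-zero n
∑-sum-comm n (x ∷ xs) f =
  trans (∑-distrib-+ (λ i → f i x) _) (cong (∑[ i < n ] f i x +_) (∑-sum-comm n xs f))

∑-last : ∀ m (g : ℕ → ℕ) → ∑[ i < suc m ] g (toℕ i) ≡ ∑[ i < m ] g (toℕ i) + g m
∑-last zero    g = +-identityʳ (g 0)
∑-last (suc m) g = trans (cong (g 0 +_) (∑-last m (g ∘ suc))) (sym (+-assoc (g 0) _ _))

∑-split : ∀ m q (g : ℕ → ℕ) →
          ∑[ i < m + q ] g (toℕ i) ≡ ∑[ i < m ] g (toℕ i) + ∑[ i < q ] g (m + toℕ i)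
∑-split zero    q g = refl
∑-split (suc m) q g = trans (cong (g 0 +_) (∑-split m q (g ∘ suc))) (sym (+-assoc (g 0) _ _))

∑-if-<ᵇ : ∀ {m N} (g : ℕ → ℕ) → N ≤ m →
             ∑[ i < m ] (if toℕ i <ᵇ N then g (toℕ i) else 0) ≡ ∑[ i < N ] g (toℕ i)
∑-if-<ᵇ {m}     {zero}  g z≤n       = sum-replicate-zero m
∑-if-<ᵇ {suc m} {suc N} g (s≤s N≤m) = cong (g 0 +_) (∑-if-<ᵇ (g ∘ suc) N≤m)

∑-if-≡ᵇ : ∀ n c (g : ℕ → ℕ) →
       ∑[ i < n ] (if toℕ i ≡ᵇ c then g (toℕ i) else 0) ≡ (if c <ᵇ n then g c else 0)
∑-if-≡ᵇ zero    c       g = refl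
∑-if-≡ᵇ (suc n) zero    g = trans (cong (g 0 +_) (sum-replicate-zero n)) (+-identityʳ (g 0))
∑-if-≡ᵇ (suc n) (suc c) g = ∑-if-≡ᵇ n c (g ∘ suc)

PeriodicFrom : ℕ → ℕ → (ℕ → ℕ) → Set
PeriodicFrom a q g = ∀ x → a ≤ x → g (q + x) ≡ g x

∑-periodic : ∀ {a q g m} → PeriodicFrom a q g → a ≤ m →
             ∑[ i < q + m ] g (toℕ i) ≡ ∑[ i < m ] g (toℕ i) + ∑[ i < q ] g (a + toℕ i)
∑-periodic {a} {q} {g} {m} periodic a≤m with m≤n⇒m<n∨m≡n a≤m
... | inj₂ refl = trans (cong (λ n → ∑[ i < n ] g (toℕ i)) (+-comm q a)) (∑-split a q g)
∑-periodic {a} {q} {g} {suc m} periodic _ | inj₁ (s≤s a≤m) = begin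
  ∑[ i < q + suc m ] g (toℕ i)            ≡⟨ cong (λ n → ∑[ i < n ] g (toℕ i)) (+-suc q m) ⟩
  ∑[ i < suc (q + m) ] g (toℕ i)          ≡⟨ ∑-last (q + m) g ⟩
  ∑[ i < q + m ] g (toℕ i) + g (q + m)    ≡⟨ cong₂ _+_ (∑-periodic periodic a≤m) (periodic m a≤m) ⟩
  ∑[ i < m ] g (toℕ i) + window + g m     ≡⟨ xy∙z≈xz∙y _ window (g m) ⟩
  ∑[ i < m ] g (toℕ i) + g m + window     ≡⟨ cong (_+ window) (∑-last m g) ⟨
  ∑[ i < suc m ] g (toℕ i) + window       ∎
  where
  window : ℕ
  window = ∑[ i < q ] g (a + toℕ i)

module _ {A : Set} {P : Pred A 0ℓ} (P? : Decidable P) where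

  length-filter-++ : ∀ xs ys →
                     length (filter P? (xs ++ ys)) ≡ length (filter P? xs) + length (filter P? ys)
  length-filter-++ xs ys = trans (cong length (filter-++ P? xs ys)) (length-++ (filter P? xs))

  length-filter-concatMap : ∀ {B : Set} {n} (f : Fin n → B) (g : B → List A) →
    length (filter P? (concatMap g (tabulate f))) ≡ ∑[ i < n ] length (filter P? (g (f i)))
  length-filter-concatMap {n = zero}  f g = refl
  length-filter-concatMap {n = suc n} f g =
    trans (length-filter-++ (g (f _)) _) (cong (_ +_) (length-filter-concatMap (f ∘ Fin.suc) g))

  length-filter-if : ∀ (c : Bool) x →
    length (filter P? (if c then x ∷ [] else [])) ≡ (if c then (if does (P? x) then 1 else 0) else 0)
  length-filter-if false x = refl
  length-filter-if true  x with does (P? x)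
  ... | true  = refl
  ... | false = refl

length-filter-edges : ∀ {n} (G : Graph n) {P : Pred (Fin n × Fin n) 0ℓ} (P? : Decidable P) →
  length (filter P? (edges G))
    ≡ ∑[ u < n ] ∑[ v < n ] (if (toℕ u <ᵇ toℕ v) ∧ adj G u v then (if does (P? (u , v)) then 1 else 0) else 0)
length-filter-edges {n} G P? =
  trans (length-filter-concatMap P? id (λ u → concatMap (edge? u) (allFin n)))
        (sum-cong-≗ λ u → trans (length-filter-concatMap P? id (edge? u))
                                (sum-cong-≗ λ v → length-filter-if P? (isEdge u v) (u , v)))
  where
  isEdge : Fin n → Fin n → Bool
  isEdge u v = (toℕ u <ᵇ toℕ v) ∧ adj G u v
  edge? : Fin n → Fin n → List (Fin n × Fin n)
  edge? u v = if isEdge u v then (u , v) ∷ [] else []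

sum-map-≡0 : ∀ {A : Set} {f : A → ℕ} {xs} → All (λ x → f x ≡ 0) xs → List.sum (map f xs) ≡ 0
sum-map-≡0 []            = refl
sum-map-≡0 (fx≡0 ∷ fxs≡0) = cong₂ _+_ fx≡0 (sum-map-≡0 fxs≡0)

any-≟-indicator : ∀ x X {xs} → AllPairs _≢_ xs →
  (if any (λ s → does (x ≟ s)) xs then X else 0)
    ≡ List.sum (map (λ s → if does (x ≟ s) then X else 0) xs)
any-≟-indicator x X []                               = refl
any-≟-indicator x X {s ∷ xs} (s≢xs ∷ distinct) = head-case (x ≟ s)
  where
  rest : ℕ
  rest = List.sum (map (λ t → if does (x ≟ t) then X else 0) xs)
  head-case : (x≟s : Dec (x ≡ s)) →
    (if does x≟s ∨ any (λ t → does (x ≟ t)) xs then X else 0) ≡ (if does x≟s then X else 0) + rest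
  head-case (yes refl) = sym (trans (cong (X +_) (sum-map-≡0 (All.map vanishes s≢xs))) (+-identityʳ X))
    where
    vanishes : ∀ {t} → x ≢ t → (if does (x ≟ t) then X else 0) ≡ 0
    vanishes x≢t = cong (if_then X else 0) (dec-false (x ≟ _) x≢t)
  head-case (no _)     = any-≟-indicator x X distinct

m+n<ᵇo≡n<ᵇo∸m : ∀ m n o → (m + n <ᵇ o) ≡ (n <ᵇ o ∸ m)
m+n<ᵇo≡n<ᵇo∸m zero    n o       = refl
m+n<ᵇo≡n<ᵇo∸m (suc m) n zero    = refl
m+n<ᵇo≡n<ᵇo∸m (suc m) n (suc o) = m+n<ᵇo≡n<ᵇo∸m m n o

parityWeight : (ℕ → ℕ) → ℕ → ℕ → ℕ → ℕ
parityWeight h b x y = if does ((h x + h y) % 2 ≟ b) then 1 else 0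

%-cong-+ : ∀ {m m′ n n′} d .{{_ : NonZero d}} →
           m % d ≡ m′ % d → n % d ≡ n′ % d → (m + n) % d ≡ (m′ + n′) % d
%-cong-+ {m} {m′} {n} {n′} d m≡m′ n≡n′ = begin
  (m + n) % d               ≡⟨ %-distribˡ-+ m n d ⟩
  (m % d + n % d) % d       ≡⟨ cong₂ (λ r s → (r + s) % d) m≡m′ n≡n′ ⟩
  (m′ % d + n′ % d) % d     ≡⟨ %-distribˡ-+ m′ n′ d ⟨
  (m′ + n′) % d             ∎

module _ {a q : ℕ} {h : ℕ → ℕ} (periodic : PeriodicFrom a q (λ x → h x % 2)) (b : ℕ) where

  parityWeight-periodicˡ : ∀ y → PeriodicFrom a q (λ x → parityWeight h b x y)
  parityWeight-periodicˡ y x a≤x =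
    cong (λ r → if does (r ≟ b) then 1 else 0) (%-cong-+ {h (q + x)} {h x} {h y} {h y} 2 (periodic x a≤x) refl)

  parityWeight-periodicʳ : ∀ x → PeriodicFrom a q (parityWeight h b x)
  parityWeight-periodicʳ x y a≤y =
    cong (λ r → if does (r ≟ b) then 1 else 0) (%-cong-+ {h x} {h x} {h (q + y)} {h y} 2 refl (periodic y a≤y))

differenceSum : ℕ → List ℕ → (ℕ → ℕ → ℕ) → ℕ
differenceSum n S w = List.sum (map (λ s → ∑[ u < n ∸ s ] w (toℕ u) (s + toℕ u)) S)

module _ (n : ℕ) .{{_ : NonZero n}} {S : List ℕ} (distinct : AllPairs _≢_ S) (positive : All (0 <_) S) where

  [v+n∸u]%n≡v∸u : ∀ {u v} → u ≤ v → v < n → (v + n ∸ u) % n ≡ v ∸ u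
  [v+n∸u]%n≡v∸u {u} {v} u≤v v<n = begin
    (v + n ∸ u) % n   ≡⟨ cong (_% n) (+-∸-comm n u≤v) ⟩
    (v ∸ u + n) % n   ≡⟨ [m+n]%n≡m%n (v ∸ u) n ⟩
    (v ∸ u) % n       ≡⟨ m<n⇒m%n≡m (≤-<-trans (m∸n≤m v u) v<n) ⟩
    v ∸ u             ∎

  adjacency-indicator : ∀ u v X → v < n →
    (if (u <ᵇ v) ∧ any (λ s → ((v + n ∸ u) % n) ≡ᵇ s) S then X else 0)
      ≡ List.sum (map (λ s → if v ≡ᵇ s + u then X else 0) S)
  adjacency-indicator u v X v<n with u <ᵇ v | <ᵇ-reflects-< u v
  ... | true  | ofʸ u<v = begin
    (if any (λ s → ((v + n ∸ u) % n) ≡ᵇ s) S then X else 0)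
      ≡⟨ cong (λ d → if any (λ s → d ≡ᵇ s) S then X else 0) ([v+n∸u]%n≡v∸u (<⇒≤ u<v) v<n) ⟩
    (if any (λ s → (v ∸ u) ≡ᵇ s) S then X else 0)
      ≡⟨ any-≟-indicator (v ∸ u) X distinct ⟩
    List.sum (map (λ s → if v ∸ u ≡ᵇ s then X else 0) S)
      ≡⟨ cong List.sum (map-cong (λ s → cong (if_then X else 0) (v∸u≡ᵇs≡v≡ᵇs+u s)) S) ⟩
    List.sum (map (λ s → if v ≡ᵇ s + u then X else 0) S) ∎
    where
    v∸u≡ᵇs≡v≡ᵇs+u : ∀ s → (v ∸ u ≡ᵇ s) ≡ (v ≡ᵇ s + u)
    v∸u≡ᵇs≡v≡ᵇs+u s = does-⇔ (mk⇔ (λ e → trans (sym (m∸n+n≡m (<⇒≤ u<v))) (cong (_+ u) e))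
                                   (λ e → trans (cong (_∸ u) e) (m+n∸n≡m s u)))
                              (v ∸ u ≟ s) (v ≟ s + u)
  ... | false | ofⁿ u≮v = sym (sum-map-≡0 (All.map vanishes positive))
    where
    vanishes : ∀ {s} → 0 < s → (if v ≡ᵇ s + u then X else 0) ≡ 0
    vanishes 0<s = cong (if_then X else 0) (dec-false (v ≟ _) (<⇒≢ (≤-<-trans (≮⇒≥ u≮v) (m<n+m u 0<s))))

  circulant-∑ : (w : ℕ → ℕ → ℕ) →
    ∑[ u < n ] ∑[ v < n ] (if (toℕ u <ᵇ toℕ v) ∧ adj (circulant n S) u v then w (toℕ u) (toℕ v) else 0)
      ≡ differenceSum n S w
  circulant-∑ w = begin
    ∑[ u < n ] ∑[ v < n ] (if (toℕ u <ᵇ toℕ v) ∧ adj (circulant n S) u v then w (toℕ u) (toℕ v) else 0)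
      ≡⟨ sum-cong-≗ {n} (λ u → sum-cong-≗ {n} λ v → adjacency-indicator (toℕ u) (toℕ v) _ (toℕ<n v)) ⟩
    ∑[ u < n ] ∑[ v < n ] List.sum (map (λ s → if toℕ v ≡ᵇ s + toℕ u then w (toℕ u) (toℕ v) else 0) S)
      ≡⟨ sum-cong-≗ {n} (λ u → ∑-sum-comm n S _) ⟩
    ∑[ u < n ] List.sum (map (λ s → ∑[ v < n ] (if toℕ v ≡ᵇ s + toℕ u then w (toℕ u) (toℕ v) else 0)) S)
      ≡⟨ sum-cong-≗ {n} (λ u → cong List.sum (map-cong (λ s → ∑-if-≡ᵇ n (s + toℕ u) (w (toℕ u))) S)) ⟩
    ∑[ u < n ] List.sum (map (λ s → if s + toℕ u <ᵇ n then w (toℕ u) (s + toℕ u) else 0) S)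
      ≡⟨ ∑-sum-comm n S _ ⟩
    List.sum (map (λ s → ∑[ u < n ] (if s + toℕ u <ᵇ n then w (toℕ u) (s + toℕ u) else 0)) S)
      ≡⟨ cong List.sum (map-cong truncate S) ⟩
    differenceSum n S w ∎
    where
    truncate : ∀ s → ∑[ u < n ] (if s + toℕ u <ᵇ n then w (toℕ u) (s + toℕ u) else 0)
                     ≡ ∑[ u < n ∸ s ] w (toℕ u) (s + toℕ u)
    truncate s = trans (sum-cong-≗ {n} λ u → cong (if_then w (toℕ u) (s + toℕ u) else 0)
                                                  (m+n<ᵇo≡n<ᵇo∸m s (toℕ u) n))
                       (∑-if-<ᵇ (λ u → w u (s + u)) (m∸n≤m n s))

  countLabel-circulant : (f : Fin n → Fin (suc n)) (ι : ℕ → ℕ) → (∀ u → toℕ (f u) ≡ ι (toℕ u)) →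
                         ∀ b → countLabel (circulant n S) f b ≡ differenceSum n S (parityWeight (fib ∘ ι) b)
  countLabel-circulant f ι toℕ∘f≗ι∘toℕ b = begin
    countLabel (circulant n S) f b
      ≡⟨ length-filter-edges (circulant n S) (λ e → edgeLabel f e ≟ b) ⟩
    ∑[ u < n ] ∑[ v < n ] (if isEdge u v then (if does (edgeLabel f (u , v) ≟ b) then 1 else 0) else 0)
      ≡⟨ sum-cong-≗ {n} (λ u → sum-cong-≗ {n} λ v → cong (if isEdge u v then_else 0) (label-weight u v)) ⟩
    ∑[ u < n ] ∑[ v < n ] (if isEdge u v then parityWeight (fib ∘ ι) b (toℕ u) (toℕ v) else 0)
      ≡⟨ circulant-∑ (parityWeight (fib ∘ ι) b) ⟩
    differenceSum n S (parityWeight (fib ∘ ι) b) ∎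
    where
    isEdge : Fin n → Fin n → Bool
    isEdge u v = (toℕ u <ᵇ toℕ v) ∧ adj (circulant n S) u v
    label-weight : ∀ u v → (if does (edgeLabel f (u , v) ≟ b) then 1 else 0)
                           ≡ parityWeight (fib ∘ ι) b (toℕ u) (toℕ v)
    label-weight u v = cong₂ (λ i j → if does ((fib i + fib j) % 2 ≟ b) then 1 else 0)
                             (toℕ∘f≗ι∘toℕ u) (toℕ∘f≗ι∘toℕ v)

differenceSum-++ : ∀ n S T w → differenceSum n (S ++ T) w ≡ differenceSum n S w + differenceSum n T w
differenceSum-++ n S T w = trans (cong List.sum (map-++ _ S T)) (sum-++ (map _ S) _)

windowSum : ℕ → ℕ → List ℕ → (ℕ → ℕ → ℕ) → ℕ
windowSum a q D w = List.sum (map (λ d → ∑[ i < q ] w (a + toℕ i) (d + (a + toℕ i))) D)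

module _ {a q : ℕ} {w : ℕ → ℕ → ℕ}
         (periodicˡ : ∀ y → PeriodicFrom a q (λ x → w x y))
         (periodicʳ : ∀ x → PeriodicFrom a q (w x)) where

  differenceSum-growth : ∀ {n D} → All (λ d → a + d ≤ n) D →
                         differenceSum (q + n) D w ≡ differenceSum n D w + windowSum a q D w
  differenceSum-growth []                        = refl
  differenceSum-growth {n} {d ∷ D} (a+d≤n ∷ bounds) =
    trans (cong₂ _+_ diagonal-growth (differenceSum-growth bounds))
          (interchange (∑[ u < n ∸ d ] w (toℕ u) (d + toℕ u)) _ (differenceSum n D w) _)
    where
    d≤n : d ≤ n
    d≤n = m+n≤o⇒n≤o a a+d≤n
    a≤n∸d : a ≤ n ∸ d
    a≤n∸d = m+n≤o⇒m≤o∸n a a+d≤n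
    diagonal-periodic : PeriodicFrom a q (λ u → w u (d + u))
    diagonal-periodic u a≤u = begin
      w (q + u) (d + (q + u)) ≡⟨ cong (w (q + u)) (x∙yz≈y∙xz d q u) ⟩
      w (q + u) (q + (d + u)) ≡⟨ periodicʳ (q + u) (d + u) (≤-trans a≤u (m≤n+m u d)) ⟩
      w (q + u) (d + u)       ≡⟨ periodicˡ (d + u) u a≤u ⟩
      w u (d + u)             ∎
    diagonal-growth : ∑[ u < q + n ∸ d ] w (toℕ u) (d + toℕ u)
                      ≡ ∑[ u < n ∸ d ] w (toℕ u) (d + toℕ u) + ∑[ i < q ] w (a + toℕ i) (d + (a + toℕ i))
    diagonal-growth = trans (cong (λ m → ∑[ u < m ] w (toℕ u) (d + toℕ u)) (+-∸-assoc q d≤n))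
                            (∑-periodic diagonal-periodic a≤n∸d)

  differenceSum-reflected : ∀ {n D} → All (λ d → a + d ≤ n) D →
                            differenceSum (q + n) (map (q + n ∸_) D) w ≡ differenceSum n (map (n ∸_) D) w
  differenceSum-reflected []                        = refl
  differenceSum-reflected {n} {d ∷ D} (a+d≤n ∷ bounds) = cong₂ _+_ wrap-around (differenceSum-reflected bounds)
    where
    d≤n : d ≤ n
    d≤n = m+n≤o⇒n≤o a a+d≤n
    a≤n∸d : a ≤ n ∸ d
    a≤n∸d = m+n≤o⇒m≤o∸n a a+d≤n
    wrap-around : ∑[ u < q + n ∸ (q + n ∸ d) ] w (toℕ u) (q + n ∸ d + toℕ u)
                  ≡ ∑[ u < n ∸ (n ∸ d) ] w (toℕ u) (n ∸ d + toℕ u)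
    wrap-around = begin
      ∑[ u < q + n ∸ (q + n ∸ d) ] w (toℕ u) (q + n ∸ d + toℕ u)
        ≡⟨ cong (λ m → ∑[ u < q + n ∸ m ] w (toℕ u) (m + toℕ u)) (+-∸-assoc q d≤n) ⟩
      ∑[ u < q + n ∸ (q + (n ∸ d)) ] w (toℕ u) (q + (n ∸ d) + toℕ u)
        ≡⟨ cong (λ m → ∑[ u < m ] w (toℕ u) (q + (n ∸ d) + toℕ u)) ([m+n]∸[m+o]≡n∸o q n (n ∸ d)) ⟩
      ∑[ u < n ∸ (n ∸ d) ] w (toℕ u) (q + (n ∸ d) + toℕ u)
        ≡⟨ sum-cong-≗ {n ∸ (n ∸ d)} (λ u → trans (cong (w (toℕ u)) (+-assoc q (n ∸ d) (toℕ u)))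
                                                  (periodicʳ (toℕ u) _ (≤-trans a≤n∸d (m≤m+n _ (toℕ u))))) ⟩
      ∑[ u < n ∸ (n ∸ d) ] w (toℕ u) (n ∸ d + toℕ u) ∎

  differenceSum-±-growth : ∀ {n} D → All (λ d → a + d ≤ n) D →
                           differenceSum (q + n) (D ++ map (q + n ∸_) D) w
                           ≡ differenceSum n (D ++ map (n ∸_) D) w + windowSum a q D w
  differenceSum-±-growth {n} D bounds = begin
    differenceSum (q + n) (D ++ map (q + n ∸_) D) w
      ≡⟨ differenceSum-++ (q + n) D _ w ⟩
    differenceSum (q + n) D w + differenceSum (q + n) (map (q + n ∸_) D) w
      ≡⟨ cong₂ _+_ (differenceSum-growth bounds) (differenceSum-reflected bounds) ⟩
    differenceSum n D w + windowSum a q D w + differenceSum n (map (n ∸_) D) w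
      ≡⟨ xy∙z≈xz∙y (differenceSum n D w) (windowSum a q D w) _ ⟩
    differenceSum n D w + differenceSum n (map (n ∸_) D) w + windowSum a q D w
      ≡⟨ cong (_+ windowSum a q D w) (differenceSum-++ n D _ w) ⟨
    differenceSum n (D ++ map (n ∸_) D) w + windowSum a q D w ∎

labelIndex : ℕ → ℕ
labelIndex 0                   = 1
labelIndex 1                   = 2
labelIndex 2                   = 0
labelIndex (suc (suc (suc i))) = suc (suc (suc i))

labelIndex³≡id : ∀ i → labelIndex (labelIndex (labelIndex i)) ≡ i
labelIndex³≡id 0                   = refl
labelIndex³≡id 1                   = refl
labelIndex³≡id 2                   = refl
labelIndex³≡id (suc (suc (suc i))) = refl

labelIndex-injective : Injective _≡_ _≡_ labelIndex
labelIndex-injective {i} {j} e =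
  trans (sym (labelIndex³≡id i)) (trans (cong (labelIndex ∘ labelIndex) e) (labelIndex³≡id j))

labelIndex-< : ∀ {m i} → i < 3 + m → labelIndex i < 3 + m
labelIndex-< {i = 0}                   _   = s≤s (s≤s z≤n)
labelIndex-< {i = 1}                   _   = s≤s (s≤s (s≤s z≤n))
labelIndex-< {i = 2}                   _   = z<s
labelIndex-< {i = suc (suc (suc i))}   i<n = i<n

labelIndex-fixed : ∀ {i} → 3 ≤ i → labelIndex i ≡ i
labelIndex-fixed (s≤s (s≤s (s≤s _))) = refl

fibLabeling : ∀ m → Fin (3 + m) → Fin (suc (3 + m))
fibLabeling m u = fromℕ< (m<n⇒m<1+n (labelIndex-< (toℕ<n u)))

toℕ-fibLabeling : ∀ m u → toℕ (fibLabeling m u) ≡ labelIndex (toℕ u)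
toℕ-fibLabeling m u = toℕ-fromℕ< _

fibLabeling-injective : ∀ m → Injective _≡_ _≡_ (fibLabeling m)
fibLabeling-injective m {u} {v} e = toℕ-injective (labelIndex-injective (begin
  labelIndex (toℕ u)     ≡⟨ toℕ-fibLabeling m u ⟨
  toℕ (fibLabeling m u)  ≡⟨ cong toℕ e ⟩
  toℕ (fibLabeling m v)  ≡⟨ toℕ-fibLabeling m v ⟩
  labelIndex (toℕ v)     ∎))

fib[3+n]≡fib[n]+fib[1+n]*2 : ∀ n → fib (3 + n) ≡ fib n + fib (1 + n) * 2
fib[3+n]≡fib[n]+fib[1+n]*2 n = solve 2 (λ a b → (a :+ b) :+ a := b :+ a :* con 2) refl (fib (1 + n)) (fib n)
  where open +-*-Solver

fib[3+n]%2≡fib[n]%2 : ∀ n → fib (3 + n) % 2 ≡ fib n % 2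
fib[3+n]%2≡fib[n]%2 n = trans (cong (_% 2) (fib[3+n]≡fib[n]+fib[1+n]*2 n)) ([m+kn]%n≡m%n (fib n) (fib (1 + n)) 2)

fib∘labelIndex-parity-periodic : PeriodicFrom 3 3 (λ i → fib (labelIndex i) % 2)
fib∘labelIndex-parity-periodic i 3≤i =
  trans (fib[3+n]%2≡fib[n]%2 i) (cong (λ j → fib j % 2) (sym (labelIndex-fixed 3≤i)))

pm1234-distinct : ∀ k → AllPairs _≢_ (pm1234 (9 + k))
pm1234-distinct k =
    ((λ ()) ∷ (λ ()) ∷ (λ ()) ∷ (λ ()) ∷ (λ ()) ∷ (λ ()) ∷ (λ ()) ∷ [])
  ∷ ((λ ()) ∷ (λ ()) ∷ (λ ()) ∷ (λ ()) ∷ (λ ()) ∷ (λ ()) ∷ [])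
  ∷ ((λ ()) ∷ (λ ()) ∷ (λ ()) ∷ (λ ()) ∷ (λ ()) ∷ [])
  ∷ ((λ ()) ∷ (λ ()) ∷ (λ ()) ∷ (λ ()) ∷ [])
  ∷ (m+1+n≢n 0 ∷ m+1+n≢n 1 ∷ m+1+n≢n 2 ∷ [])
  ∷ (m+1+n≢n 0 ∷ m+1+n≢n 1 ∷ [])
  ∷ (m+1+n≢n 0 ∷ [])
  ∷ [] ∷ []

pm1234-positive : ∀ k → All (0 <_) (pm1234 (9 + k))
pm1234-positive k = z<s ∷ z<s ∷ z<s ∷ z<s ∷ z<s ∷ z<s ∷ z<s ∷ z<s ∷ []

ε : ℕ → ℕ → ℕ
ε b n = differenceSum n (pm1234 n) (parityWeight (fib ∘ labelIndex) b)

ε-growth : ∀ b k → ε b (12 + k)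
                    ≡ ε b (9 + k) + windowSum 3 3 (1 ∷ 2 ∷ 3 ∷ 4 ∷ []) (parityWeight (fib ∘ labelIndex) b)
ε-growth b k = differenceSum-±-growth {3} {3} {w} periodicˡ periodicʳ (1 ∷ 2 ∷ 3 ∷ 4 ∷ []) bounds
  where
  w : ℕ → ℕ → ℕ
  w = parityWeight (fib ∘ labelIndex) b
  periodicˡ : ∀ y → PeriodicFrom 3 3 (λ x → w x y)
  periodicˡ = parityWeight-periodicˡ {3} {3} {fib ∘ labelIndex} fib∘labelIndex-parity-periodic b
  periodicʳ : ∀ x → PeriodicFrom 3 3 (w x)
  periodicʳ = parityWeight-periodicʳ {3} {3} {fib ∘ labelIndex} fib∘labelIndex-parity-periodic b
  bounds : All (λ d → 3 + d ≤ 9 + k) (1 ∷ 2 ∷ 3 ∷ 4 ∷ [])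
  bounds = m≤m+n 4 (5 + k) ∷ m≤m+n 5 (4 + k) ∷ m≤m+n 6 (3 + k) ∷ m≤m+n 7 (2 + k) ∷ []

ε-balanced : ∀ k → ε 0 (9 + k) ≡ ε 1 (9 + k)
ε-balanced 0                   = refl
ε-balanced 1                   = refl
ε-balanced 2                   = refl
ε-balanced (suc (suc (suc k))) = begin
  ε 0 (12 + k)     ≡⟨ ε-growth 0 k ⟩
  ε 0 (9 + k) + 6  ≡⟨ cong (_+ 6) (ε-balanced k) ⟩
  ε 1 (9 + k) + 6  ≡⟨ ε-growth 1 k ⟨
  ε 1 (12 + k)     ∎

equalCounts⇒FibonacciCordial : ∀ {n} {G : Graph n} (f : Fin n → Fin (suc n)) → Injective _≡_ _≡_ f →
                               countLabel G f 0 ≡ countLabel G f 1 → FibonacciCordial G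
equalCounts⇒FibonacciCordial f injective ε₀≡ε₁ = record
  { labeling = f
  ; isFC     = injective
               , m≤n⇒m≤1+n (≤-reflexive ε₀≡ε₁)
               , m≤n⇒m≤1+n (≤-reflexive (sym ε₀≡ε₁))
  }

Γ-fibonacciCordial : ∀ k → FibonacciCordial (circulant (9 + k) (pm1234 (9 + k)))
Γ-fibonacciCordial k = equalCounts⇒FibonacciCordial f (fibLabeling-injective (6 + k)) (begin
  countLabel Γ f 0  ≡⟨ count 0 ⟩
  ε 0 (9 + k)       ≡⟨ ε-balanced k ⟩
  ε 1 (9 + k)       ≡⟨ count 1 ⟨
  countLabel Γ f 1  ∎)
  where
  Γ : Graph (9 + k)
  Γ = circulant (9 + k) (pm1234 (9 + k))
  f : Fin (9 + k) → Fin (10 + k)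
  f = fibLabeling (6 + k)
  count : ∀ b → countLabel Γ f b ≡ ε b (9 + k)
  count = countLabel-circulant (9 + k) (pm1234-distinct k) (pm1234-positive k)
                               f labelIndex (toℕ-fibLabeling (6 + k))

mainTheorem11 : (n : ℕ) → .{{_ : NonZero n}} → 8 < n →
                FibonacciCordial (circulant n (pm1234 n))
mainTheorem11 n 8<n with m≤n⇒∃[o]m+o≡n 8<n
... | k , refl = Γ-fibonacciCordial k
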